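{- For a given stable matching instance with one-sided uncertainty and a stable matching $M$, there is a $1$-competitive algorithm for verifying that $M$ is stable in the interview query model.
   Context: Two disjoint sets $A$, $B$ of agents with $|A|=|B|=n$. Each $a\in A$ has a strict total order $\prec_a$ on $B$ and each $b\in B$ has a strict total order $\prec_b$ on $A$ ($x\prec_y z$: $y$ prefers $x$ to $z$). A matching is a bijection between $A$ and $B$; it is stable if there is no pair $(a,b)$, $b\neq M(a)$, with $a$ preferring $b$ to $M(a)$ and $b$ preferring $a$ to $M(b)$. One-sided uncertainty: the orders $\prec_a$ ($a\in A$) are known, the orders $\prec_b$ ($b\in B$) are unknown and learned only via queries. An interview query $\mathit{intq}(b,a)$ for $b\in B$, $a\in A$ reveals the restriction of $\prec_b$ to $\{a\}\cup P_b$, where $P_b$ is the set of all $a'\in A$ for which $\mathit{intq}(b,a')$ was executed before. An algorithm queries adaptively until the known information proves its output correct (for every consistent $B$-side profile). It is $\rho$-competitive if its number of queries is at most $\rho$ times the minimum size of a query set whose answers suffice to prove the correct output; for this verification problem the ratio is measured only on inputs where $M$ is stable, and otherwise the algorithm must detect that $M$ is not stable. -}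

module Defs where

open import Data.Nat using (ℕ; zero; suc; _≤_)
open import Data.Fin using (Fin; _≟_) renaming (_<_ to _<ᶠ_; _<?_ to _<ᶠ?_)
open import Data.Fin.Permutation using (Permutation′; _⟨$⟩ʳ_; _⟨$⟩ˡ_)
open import Data.Product using (_×_; _,_; Σ)
open import Data.Product.Properties using (≡-dec)
open import Data.List using (List; []; _∷_; _++_; [_]; length)
open import Data.List.Membership.Propositional using (_∈_)
open import Data.Bool using (Bool; true; false; _∧_)
open import Data.Maybe using (Maybe; just; nothing)
open import Relation.Binary.PropositionalEquality using (_≡_; _≢_)
open import Relation.Nullary using (¬_; does)
open import Function.Bundles using (_⇔_)
import Data.List.Membership.DecPropositional as DecMem

-- Agents: A = Fin n, B = Fin n.
-- A strict total order on an n-element set is given by a ranking,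
-- i.e. a bijection to positions Fin n (position 0 = most preferred).
Ranking : ℕ → Set
Ranking n = Permutation′ n

Prefers : ∀ {n} → Ranking n → Fin n → Fin n → Set
Prefers r x y = (r ⟨$⟩ʳ x) <ᶠ (r ⟨$⟩ʳ y)

-- A-side profile: each a ∈ A ranks B.  B-side profile: each b ∈ B ranks A.
ProfileA : ℕ → Set
ProfileA n = Fin n → Ranking n

ProfileB : ℕ → Set
ProfileB n = Fin n → Ranking n

-- A matching is a bijection A → B:  M ⟨$⟩ʳ a ∈ B, M ⟨$⟩ˡ b ∈ A.
Matching : ℕ → Set
Matching n = Permutation′ n

Stable : ∀ {n} → ProfileA n → ProfileB n → Matching n → Set
Stable α π M =
  ∀ a b → b ≢ (M ⟨$⟩ʳ a) → Prefers (α a) b (M ⟨$⟩ʳ a) →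
    ¬ Prefers (π b) a (M ⟨$⟩ˡ b)

-- An interview query intq(b , a) is a pair (b , a) ∈ B × A.
Query : ℕ → Set
Query n = Fin n × Fin n

_∈?q_ : ∀ {n} → Query n → List (Query n) → Bool
_∈?q_ {n} q qs = does (DecMem._∈?_ (≡-dec (_≟_ {n}) _≟_) q qs)

-- The information revealed by the interview queries qs under the true
-- B-side profile π: for each b, the restriction of ≺_b to
-- P_b = { a | intq(b , a) executed }.  (This restriction does not depend
-- on the order in which the queries were executed.)
-- view π qs b a a' = true  iff  a, a' ∈ P_b and a ≺_b a'.
view : ∀ {n} → ProfileB n → List (Query n) → Fin n → Fin n → Fin n → Bool
view π qs b a a' =
  ((b , a) ∈?q qs) ∧ (((b , a') ∈?q qs) ∧ does (((π b) ⟨$⟩ʳ a) <ᶠ? ((π b) ⟨$⟩ʳ a')))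

Consistent : ∀ {n} → ProfileB n → ProfileB n → List (Query n) → Set
Consistent π π' qs =
  ∀ b a a' → (b , a) ∈ qs → (b , a') ∈ qs →
    (Prefers (π b) a a' ⇔ Prefers (π' b) a a')

-- An adaptive algorithm: given the queries executed so far and the
-- information they revealed, either execute another query or stop with
-- a verdict (true = "M is stable", false = "M is not stable").
data Action (n : ℕ) : Set where
  ask  : Query n → Action n
  stop : Bool → Action n

Algorithm : ℕ → Set
Algorithm n = List (Query n) → (Fin n → Fin n → Fin n → Bool) → Action n

run : ∀ {n} → ℕ → Algorithm n → ProfileB n → List (Query n) →
      Maybe (List (Query n) × Bool)
run zero    alg π qs = nothing
run (suc k) alg π qs with alg qs (view π qs)
... | ask q  = run k alg π (qs ++ [ q ])
... | stop v = just (qs , v)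

-- The algorithm is a correct verifier that is 1-competitive on the
-- instance (α , M): for every B-side profile π it terminates with
-- executed queries qs and verdict v such that
--  * the revealed information proves the verdict (for every consistent
--    profile π', M is stable under π' iff v = true), and
--  * if M is stable under π, the number of executed queries is at most
--    the size of any query set whose answers prove that M is stable.
OneCompetitiveVerifier : ∀ {n} → ProfileA n → Matching n → Algorithm n → Set
OneCompetitiveVerifier {n} α M alg =
  ∀ (π : ProfileB n) →
    Σ ℕ λ k → Σ (List (Query n)) λ qs → Σ Bool λ v →
      (run k alg π [] ≡ just (qs , v))
      × (∀ π' → Consistent π π' qs → (Stable α π' M ⇔ (v ≡ true)))
      × (Stable α π M →
          ∀ (qs' : List (Query n)) →
            (∀ π' → Consistent π π' qs' → Stable α π' M) →
            length qs ≤ length qs')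

module Submission where

-- Whether a prefers b to M(a) is known in advance, and for such a pair (a , b)
-- blocks M iff a ≺ᵦ M⁻¹(b).  So interviewing b with a and with M⁻¹(b), for all
-- these pairs, decides stability.  Conversely, a query set proving stability
-- must contain each of these queries: if it misses intq(b , a) (resp.
-- intq(b , M⁻¹(b))), moving a to the top (resp. M⁻¹(b) to the bottom) of ≺ᵦ is
-- consistent with its answers and makes (a , b) blocking.

open import Defs
open import Data.Nat using (ℕ; suc; _≤_; z≤n; s≤s)
open import Data.Nat.Properties using (≰⇒>; <⇒≱; module ≤-Reasoning)
open import Data.Fin using (Fin; zero; fromℕ; punchIn; punchOut; _≟_; _<?_)
  renaming (_<_ to _<ᶠ_)
open import Data.Fin.Properties
  using ( punchIn-mono-≤; punchIn-cancel-≤; punchIn-punchOut; ≤fromℕ; ≤∧≢⇒<; <-irrefl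
        ; any?; all?)
open import Data.Fin.Permutation
  using (_⟨$⟩ʳ_; _⟨$⟩ˡ_; insert; remove; insert-punchIn; punchIn-permute; inverseˡ; inverseʳ)
open import Data.Vec.Functional using (updateAt)
open import Data.Vec.Functional.Properties using (updateAt-updates; updateAt-minimal)
open import Data.Product using (Σ; ∃; _×_; _,_; proj₁; proj₂)
open import Data.Product.Properties using (≡-dec)
open import Data.Sum using (_⊎_; inj₁; inj₂)
open import Data.Bool using (Bool; true; false)
import Data.Bool.Properties as Bool
open import Data.Maybe using (just)
open import Data.List using (List; []; _∷_; _++_; [_]; length; drop; filter; cartesianProduct; allFin)
open import Data.List.Properties using (++-assoc; ++-identityʳ)
open import Data.List.Membership.Propositional using (_∈_; _∉_)
open import Data.List.Membership.Propositional.Properties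
  using (∈-∃++; ∈-filter⁺; ∈-filter⁻; ∈-cartesianProduct⁺; ∈-allFin)
import Data.List.Membership.DecPropositional as DecMembership
open import Data.List.Relation.Binary.Subset.Propositional using (_⊆_)
open import Data.List.Relation.Binary.Permutation.Propositional.Properties
  using (∈-resp-↭; ↭-length; shift)
open import Data.List.Relation.Unary.Any using (here; there)
open import Data.List.Relation.Unary.Unique.Propositional using (Unique)
open import Data.List.Relation.Unary.Unique.Propositional.Properties
  using (filter⁺; cartesianProduct⁺; allFin⁺; Unique[x∷xs]⇒x∉xs)
open import Data.List.Relation.Unary.AllPairs using (_∷_)
open import Function.Base using (const; _∘_)
open import Function.Bundles using (_⇔_; mk⇔; Equivalence)
open import Function.Construct.Identity using (⇔-id)
open import Function.Construct.Symmetry using (⇔-sym)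
open import Function.Construct.Composition using (_⇔-∘_)
open import Relation.Binary.PropositionalEquality
  using (_≡_; _≢_; refl; sym; trans; cong; subst; subst₂)
open import Relation.Nullary using (¬_; Dec; yes; no; does; contradiction)
open import Relation.Nullary.Decidable
  using (dec-true; decidable-stable; _×-dec_; _⊎-dec_; _→-dec_)

drop-prefix : ∀ {A : Set} (xs : List A) {ys zs : List A} →
  xs ++ ys ≡ zs → drop (length xs) zs ≡ ys
drop-prefix []       refl = refl
drop-prefix (x ∷ xs) refl = drop-prefix xs refl

Unique-⊆⇒length≤ : ∀ {A : Set} {xs ys : List A} → Unique xs → xs ⊆ ys → length xs ≤ length ys
Unique-⊆⇒length≤ {xs = []}     _ _ = z≤n
Unique-⊆⇒length≤ {xs = x ∷ xs} u@(_ ∷ uxs) x∷xs⊆ys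
  with p , s , refl ← ∈-∃++ (x∷xs⊆ys (here refl)) =
  begin
    suc (length xs)          ≤⟨ s≤s (Unique-⊆⇒length≤ uxs xs⊆p++s) ⟩
    length (x ∷ p ++ s)      ≡⟨ ↭-length (shift x p s) ⟨
    length (p ++ [ x ] ++ s) ∎
  where
  open ≤-Reasoning
  xs⊆p++s : xs ⊆ p ++ s
  xs⊆p++s z∈xs with ∈-resp-↭ (shift x p s) (x∷xs⊆ys (there z∈xs))
  ... | here refl     = contradiction z∈xs (Unique[x∷xs]⇒x∉xs u)
  ... | there z∈p++s = z∈p++s

does≡true⇔ : ∀ {A : Set} (a? : Dec A) → (does a? ≡ true) ⇔ A
does≡true⇔ (yes a)  = mk⇔ (const a) (const refl)
does≡true⇔ (no ¬a) = mk⇔ (λ ()) (λ a → contradiction a ¬a)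

does≡false⇔ : ∀ {A : Set} (a? : Dec A) → (does a? ≡ false) ⇔ (¬ A)
does≡false⇔ (yes a)  = mk⇔ (λ ()) (λ ¬a → contradiction a ¬a)
does≡false⇔ (no ¬a) = mk⇔ (const ¬a) (const refl)

punchIn-<⇔ : ∀ {m} (i : Fin (suc m)) {j k : Fin m} → (punchIn i j <ᶠ punchIn i k) ⇔ (j <ᶠ k)
punchIn-<⇔ i {j} {k} = mk⇔
  (λ ij<ik → ≰⇒> (λ k≤j → <⇒≱ ij<ik (punchIn-mono-≤ i k j k≤j)))
  (λ j<k → ≰⇒> (λ ik≤ij → <⇒≱ j<k (punchIn-cancel-≤ i k j ik≤ij)))


prefers? : ∀ {n} (r : Ranking n) (x y : Fin n) → Dec (Prefers r x y)
prefers? r x y = (r ⟨$⟩ʳ x) <? (r ⟨$⟩ʳ y)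

ranking-injective : ∀ {n} (r : Ranking n) {x y : Fin n} → x ≢ y → r ⟨$⟩ʳ x ≢ r ⟨$⟩ʳ y
ranking-injective r {x} {y} x≢y rx≡ry =
  x≢y (trans (sym (inverseˡ r)) (trans (cong (r ⟨$⟩ˡ_) rx≡ry) (inverseˡ r)))

SameOrderExcept : ∀ {n} → Ranking n → Ranking n → Fin n → Set
SameOrderExcept r r′ u = ∀ {x y} → x ≢ u → y ≢ u → Prefers r x y ⇔ Prefers r′ x y

sameOrderExcept-punchIn : ∀ {m} {r r′ : Ranking (suc m)} {u : Fin (suc m)} →
  (∀ {k l} → Prefers r (punchIn u k) (punchIn u l) ⇔ Prefers r′ (punchIn u k) (punchIn u l)) →
  SameOrderExcept r r′ u
sameOrderExcept-punchIn {r = r} {r′} agree x≢u y≢u =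
  subst₂ (λ x y → Prefers r x y ⇔ Prefers r′ x y)
    (punchIn-punchOut (x≢u ∘ sym)) (punchIn-punchOut (y≢u ∘ sym)) agree

prefers-punchIn⇔remove : ∀ {m} (r : Ranking (suc m)) (u : Fin (suc m)) {k l : Fin m} →
  Prefers r (punchIn u k) (punchIn u l) ⇔ Prefers (remove u r) k l
prefers-punchIn⇔remove r u {k} {l} =
  subst₂ (λ i j → (i <ᶠ j) ⇔ Prefers (remove u r) k l)
    (sym (punchIn-permute r u k)) (sym (punchIn-permute r u l)) (punchIn-<⇔ (r ⟨$⟩ʳ u))

moveTo : ∀ {m} → Ranking (suc m) → Fin (suc m) → Fin (suc m) → Ranking (suc m)
moveTo r u t = insert u t (remove u r)

moveTo-self : ∀ {m} (r : Ranking (suc m)) (u t : Fin (suc m)) → moveTo r u t ⟨$⟩ʳ u ≡ t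
moveTo-self r u t with u ≟ u
... | yes _   = refl
... | no u≢u = contradiction refl u≢u

moveTo-prefers-punchIn⇔remove : ∀ {m} (r : Ranking (suc m)) (u t : Fin (suc m)) {k l : Fin m} →
  Prefers (moveTo r u t) (punchIn u k) (punchIn u l) ⇔ Prefers (remove u r) k l
moveTo-prefers-punchIn⇔remove r u t {k} {l} =
  subst₂ (λ i j → (i <ᶠ j) ⇔ Prefers (remove u r) k l)
    (sym (insert-punchIn u t (remove u r) k)) (sym (insert-punchIn u t (remove u r) l)) (punchIn-<⇔ t)

moveTo-sameOrderExcept : ∀ {m} (r : Ranking (suc m)) (u t : Fin (suc m)) →
  SameOrderExcept r (moveTo r u t) u
moveTo-sameOrderExcept r u t = sameOrderExcept-punchIn {r = r} {moveTo r u t} {u}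
  (⇔-sym (moveTo-prefers-punchIn⇔remove r u t) ⇔-∘ prefers-punchIn⇔remove r u)

moveTo-≢ : ∀ {m} (r : Ranking (suc m)) (u t : Fin (suc m)) {x : Fin (suc m)} →
  x ≢ u → moveTo r u t ⟨$⟩ʳ x ≢ t
moveTo-≢ r u t {x} x≢u =
  subst (moveTo r u t ⟨$⟩ʳ x ≢_) (moveTo-self r u t) (ranking-injective (moveTo r u t) x≢u)

moveToFront : ∀ {n} (r : Ranking n) (u : Fin n) →
  Σ (Ranking n) λ r′ → (∀ {x} → x ≢ u → Prefers r′ u x) × SameOrderExcept r r′ u
moveToFront {suc m} r u = moveTo r u zero , front , moveTo-sameOrderExcept r u zero
  where
  front : ∀ {x} → x ≢ u → Prefers (moveTo r u zero) u x
  front {x} x≢u = subst (_<ᶠ moveTo r u zero ⟨$⟩ʳ x) (sym (moveTo-self r u zero))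
    (≤∧≢⇒< z≤n (moveTo-≢ r u zero x≢u ∘ sym))

moveToBack : ∀ {n} (r : Ranking n) (u : Fin n) →
  Σ (Ranking n) λ r′ → (∀ {x} → x ≢ u → Prefers r′ x u) × SameOrderExcept r r′ u
moveToBack {suc m} r u = moveTo r u (fromℕ m) , back , moveTo-sameOrderExcept r u (fromℕ m)
  where
  back : ∀ {x} → x ≢ u → Prefers (moveTo r u (fromℕ m)) x u
  back {x} x≢u = subst (moveTo r u (fromℕ m) ⟨$⟩ʳ x <ᶠ_) (sym (moveTo-self r u (fromℕ m)))
    (≤∧≢⇒< (≤fromℕ _) (moveTo-≢ r u (fromℕ m) x≢u))


_∈?_ : ∀ {n} (q : Query n) (qs : List (Query n)) → Dec (q ∈ qs)
_∈?_ {n} = DecMembership._∈?_ (≡-dec (_≟_ {n}) _≟_)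

view-asked : ∀ {n} (π : ProfileB n) {qs : List (Query n)} {b x y : Fin n} →
  (b , x) ∈ qs → (b , y) ∈ qs → view π qs b x y ≡ does (prefers? (π b) x y)
view-asked π {qs} {b} {x} {y} bx∈qs by∈qs
  rewrite dec-true ((b , x) ∈? qs) bx∈qs | dec-true ((b , y) ∈? qs) by∈qs = refl

Consistent-sym : ∀ {n} {π π′ : ProfileB n} {qs : List (Query n)} → Consistent π π′ qs → Consistent π′ π qs
Consistent-sym consistent b x y bx∈qs by∈qs = ⇔-sym (consistent b x y bx∈qs by∈qs)

updateAt-consistent : ∀ {n} (π : ProfileB n) (b u : Fin n) {r′ : Ranking n} {qs : List (Query n)} →
  SameOrderExcept (π b) r′ u → (b , u) ∉ qs → Consistent π (updateAt π b (const r′)) qs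
updateAt-consistent π b u {r′} {qs} agree bu∉qs c x y cx∈qs cy∈qs with c ≟ b
... | yes refl rewrite updateAt-updates b {const r′} π =
  agree (λ { refl → bu∉qs cx∈qs }) (λ { refl → bu∉qs cy∈qs })
... | no c≢b rewrite updateAt-minimal c b {const r′} π c≢b = ⇔-id _


Revealed : ℕ → Set
Revealed n = Fin n → Fin n → Fin n → Bool

nextOrStop : ∀ {n} → Bool → List (Query n) → Action n
nextOrStop v []      = stop v
nextOrStop v (q ∷ _) = ask q

queryAllThen : ∀ {n} → List (Query n) → (Revealed n → Bool) → Algorithm n
queryAllThen qs decide asked revealed = nextOrStop (decide revealed) (drop (length asked) qs)

module _ {n} (qs : List (Query n)) (decide : Revealed n → Bool) (π : ProfileB n) where

  private
    alg : Algorithm n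
    alg = queryAllThen qs decide

    run-ask : ∀ {k asked q rest} → drop (length asked) qs ≡ q ∷ rest →
      run (suc k) alg π asked ≡ run k alg π (asked ++ [ q ])
    run-ask eq rewrite eq = refl

    run-stop : ∀ {k asked} → drop (length asked) qs ≡ [] →
      run (suc k) alg π asked ≡ just (asked , decide (view π asked))
    run-stop eq rewrite eq = refl

    run-from : ∀ asked rest → asked ++ rest ≡ qs →
      run (suc (length rest)) alg π asked ≡ just (qs , decide (view π qs))
    run-from asked [] eq =
      trans (run-stop {asked = asked} (drop-prefix asked eq))
            (cong (λ l → just (l , decide (view π l))) (trans (sym (++-identityʳ asked)) eq))
    run-from asked (q ∷ rest) eq =
      trans (run-ask {asked = asked} (drop-prefix asked eq))
            (run-from (asked ++ [ q ]) rest (trans (++-assoc asked [ q ] rest) eq))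

  run-queryAllThen :
    run (suc (length qs)) (queryAllThen qs decide) π [] ≡ just (qs , decide (view π qs))
  run-queryAllThen = run-from [] qs refl

module Verification {n} (α : ProfileA n) (M : Matching n) where

  partner : Fin n → Fin n
  partner b = M ⟨$⟩ˡ b

  Envies : Fin n → Fin n → Set
  Envies a b = Prefers (α a) b (M ⟨$⟩ʳ a)

  envies? : ∀ a b → Dec (Envies a b)
  envies? a b = prefers? (α a) b (M ⟨$⟩ʳ a)

  envies⇒≢match : ∀ {a b} → Envies a b → b ≢ M ⟨$⟩ʳ a
  envies⇒≢match a≺b refl = <-irrefl refl a≺b

  envies⇒≢partner : ∀ {a b} → Envies a b → a ≢ partner b
  envies⇒≢partner a≺b refl = envies⇒≢match a≺b (sym (inverseʳ M))

  NoBlockingPair : ProfileB n → Set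
  NoBlockingPair π = ∀ a b → Envies a b → ¬ Prefers (π b) a (partner b)

  stable⇔noBlockingPair : ∀ π → Stable α π M ⇔ NoBlockingPair π
  stable⇔noBlockingPair π = mk⇔
    (λ stable a b a≺b → stable a b (envies⇒≢match a≺b) a≺b)
    (λ noBlocking a b _ → noBlocking a b)

  Required : Query n → Set
  Required (b , x) = ∃ λ a → Envies a b × (x ≡ a ⊎ x ≡ partner b)

  required? : ∀ q → Dec (Required q)
  required? (b , x) = any? λ a → envies? a b ×-dec ((x ≟ a) ⊎-dec (x ≟ partner b))

  allQueries : List (Query n)
  allQueries = cartesianProduct (allFin n) (allFin n)

  requiredQueries : List (Query n)
  requiredQueries = filter required? allQueries

  requiredQueries-unique : Unique requiredQueries
  requiredQueries-unique = filter⁺ required? (cartesianProduct⁺ (allFin⁺ n) (allFin⁺ n))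

  required∈requiredQueries : ∀ {q} → Required q → q ∈ requiredQueries
  required∈requiredQueries {b , x} =
    ∈-filter⁺ required? (∈-cartesianProduct⁺ (∈-allFin b) (∈-allFin x))

  NoRevealedBlock : Revealed n → Set
  NoRevealedBlock revealed = ∀ a b → Envies a b → revealed b a (partner b) ≡ false

  noRevealedBlock? : ∀ revealed → Dec (NoRevealedBlock revealed)
  noRevealedBlock? revealed =
    all? λ a → all? λ b → envies? a b →-dec (revealed b a (partner b) Bool.≟ false)

  verifier : Algorithm n
  verifier = queryAllThen requiredQueries (does ∘ noRevealedBlock?)

  verdict : ProfileB n → Bool
  verdict π = does (noRevealedBlock? (view π requiredQueries))

  verdict⇔noBlockingPair : ∀ π → (verdict π ≡ true) ⇔ NoBlockingPair π
  verdict⇔noBlockingPair π =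
    mk⇔ (λ noRevealed a b a≺b → Equivalence.to (unblocked a b a≺b) (noRevealed a b a≺b))
        (λ noBlocking a b a≺b → Equivalence.from (unblocked a b a≺b) (noBlocking a b a≺b))
    ⇔-∘ does≡true⇔ (noRevealedBlock? (view π requiredQueries))
    where
    unblocked : ∀ a b → Envies a b →
      (view π requiredQueries b a (partner b) ≡ false) ⇔ (¬ Prefers (π b) a (partner b))
    unblocked a b a≺b =
      subst (λ v → (v ≡ false) ⇔ (¬ Prefers (π b) a (partner b)))
        (sym (view-asked π (required∈requiredQueries (a , a≺b , inj₁ refl))
                           (required∈requiredQueries (a , a≺b , inj₂ refl))))
        (does≡false⇔ (prefers? (π b) a (partner b)))

  consistent-noBlockingPair : ∀ {π π′} →
    Consistent π π′ requiredQueries → NoBlockingPair π → NoBlockingPair π′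
  consistent-noBlockingPair consistent noBlocking a b a≺b =
    noBlocking a b a≺b ∘ Equivalence.from (consistent b a (partner b)
      (required∈requiredQueries (a , a≺b , inj₁ refl))
      (required∈requiredQueries (a , a≺b , inj₂ refl)))

  verdict-correct : ∀ π π′ →
    Consistent π π′ requiredQueries → Stable α π′ M ⇔ (verdict π ≡ true)
  verdict-correct π π′ consistent =
    ⇔-sym (verdict⇔noBlockingPair π)
    ⇔-∘ (mk⇔ (consistent-noBlockingPair {π′} {π} (Consistent-sym {π = π} {π′} consistent))
             (consistent-noBlockingPair {π} {π′} consistent)
         ⇔-∘ stable⇔noBlockingPair π′)

  ProvesStable : ProfileB n → List (Query n) → Set
  ProvesStable π qs = ∀ π′ → Consistent π π′ qs → Stable α π′ M

  provesStable⇒asks : ∀ {π qs a b} → ProvesStable π qs → Envies a b →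
    ((b , a) ∈ qs) × ((b , partner b) ∈ qs)
  provesStable⇒asks {π} {qs} {a} {b} proves a≺b
    with moveToFront (π b) a | moveToBack (π b) (partner b)
  ... | r₁ , front , agree₁ | r₂ , back , agree₂ =
    mustAsk r₁ (front (envies⇒≢partner a≺b ∘ sym)) agree₁ ,
    mustAsk r₂ (back (envies⇒≢partner a≺b)) agree₂
    where
    mustAsk : ∀ {u} (r′ : Ranking n) →
      Prefers r′ a (partner b) → SameOrderExcept (π b) r′ u → (b , u) ∈ qs
    mustAsk {u} r′ a≺′partner agree = decidable-stable ((b , u) ∈? qs) λ bu∉qs →
      proves (updateAt π b (const r′)) (updateAt-consistent π b u agree bu∉qs)
        a b (envies⇒≢match a≺b) a≺b
        (subst (λ r → Prefers r a (partner b)) (sym (updateAt-updates b π)) a≺′partner)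

  requiredQueries-minimal : ∀ {π qs} → ProvesStable π qs → length requiredQueries ≤ length qs
  requiredQueries-minimal {π} {qs} proves =
    Unique-⊆⇒length≤ requiredQueries-unique requiredQueries⊆qs
    where
    requiredQueries⊆qs : requiredQueries ⊆ qs
    requiredQueries⊆qs q∈required with ∈-filter⁻ required? {xs = allQueries} q∈required
    ... | _ , a , a≺b , inj₁ refl = proj₁ (provesStable⇒asks {π} proves a≺b)
    ... | _ , a , a≺b , inj₂ refl = proj₂ (provesStable⇒asks {π} proves a≺b)

lemma16 : (n : ℕ) (α : ProfileA n) (M : Matching n) →
    Σ (Algorithm n) λ alg → OneCompetitiveVerifier α M alg
lemma16 n α M = verifier , λ π →
    suc (length requiredQueries) , requiredQueries , verdict π ,
    run-queryAllThen requiredQueries (does ∘ noRevealedBlock?) π ,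
    verdict-correct π ,
    λ _ qs′ → requiredQueries-minimal {π} {qs′}
  where open Verification α M
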